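{- For every $a : \mathrm{Tree}$, the type $\mathrm{isCNF}(a)$ is a proposition, i.e. any two of its elements are equal (connected by a path).
   Context: Work in cubical type theory (as implemented in cubical Agda); $x \equiv y$ denotes the path type, $A \uplus B$ the coproduct. $\mathrm{Tree}$ is the inductive type with constructors $\mathbf{0} : \mathrm{Tree}$ and $\omega^{a} + b : \mathrm{Tree}$ for $a, b : \mathrm{Tree}$. The relation $a < b$ on $\mathrm{Tree}$ is the inductive family generated by: $\mathbf{0} < \omega^a + b$; if $a < c$ then $\omega^a + b < \omega^c + d$; if $a \equiv c$ and $b < d$ then $\omega^a + b < \omega^c + d$. Put $a \geq b := (b < a) \uplus (a \equiv b)$, and $\mathrm{fst}(\mathbf{0}) = \mathbf{0}$, $\mathrm{fst}(\omega^a + b) = a$. The predicate $\mathrm{isCNF}$ on $\mathrm{Tree}$ is the inductive family generated by: $\mathrm{isCNF}(\mathbf{0})$; and if $\mathrm{isCNF}(a)$, $\mathrm{isCNF}(b)$ and $a \geq \mathrm{fst}(b)$, then $\mathrm{isCNF}(\omega^a + b)$. -}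

{-# OPTIONS --without-K #-}
module Defs where

open import Relation.Binary.PropositionalEquality using (_≡_)
open import Data.Sum using (_⊎_)

-- Binary trees representing ordinal notations: 𝟎 and ω^ a + b.
data Tree : Set where
  𝟎    : Tree
  ω^_+_ : Tree → Tree → Tree

infix 4 _<_ _≥_

data _<_ : Tree → Tree → Set where
  <₁ : ∀ {a b} → 𝟎 < ω^ a + b
  <₂ : ∀ {a b c d} → a < c → ω^ a + b < ω^ c + d
  <₃ : ∀ {a b c d} → a ≡ c → b < d → ω^ a + b < ω^ c + d

_≥_ : Tree → Tree → Set
a ≥ b = (b < a) ⊎ (a ≡ b)

fst : Tree → Tree
fst 𝟎 = 𝟎
fst (ω^ a + b) = a

data isCNF : Tree → Set where
  𝟎IsCNF : isCNF 𝟎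
  ω^+IsCNF : ∀ {a b} → isCNF a → isCNF b → a ≥ fst b → isCNF (ω^ a + b)

isProp : ∀ {ℓ} → Set ℓ → Set ℓ
isProp A = (x y : A) → x ≡ y

-- Equality on Tree is decidable, so by Hedberg's
-- theorem Tree is a set: any two equality proofs between trees coincide.
-- The order _<_ is irreflexive, and each pair of trees is related by at most
-- one of its three constructors (the <₂/<₃ overlap would force a < a), so by
-- induction on the derivations _<_ is proposition-valued.  Hence a ≥ b, a sum
-- of two mutually exclusive propositions, is a proposition.  Finally, an
-- isCNF derivation of ω^ a + b consists of derivations for a and b together
-- with a proof of a ≥ fst b; induction on the tree gives the theorem.
module Submission where

open import Defs
open import Relation.Binary.PropositionalEquality using (_≡_; refl; cong; cong₂)
open import Relation.Binary.Definitions using (DecidableEquality)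
open import Relation.Nullary using (yes; no)
open import Data.Sum using (_⊎_; inj₁; inj₂)
open import Data.Empty using (⊥; ⊥-elim)
open import Axiom.UniquenessOfIdentityProofs using (module Decidable⇒UIP)

_≟_ : DecidableEquality Tree
𝟎 ≟ 𝟎 = yes refl
𝟎 ≟ (ω^ _ + _) = no (λ ())
(ω^ _ + _) ≟ 𝟎 = no (λ ())
(ω^ a + b) ≟ (ω^ c + d) with a ≟ c | b ≟ d
... | yes refl | yes refl = yes refl
... | no a≢c   | _        = no (λ { refl → a≢c refl })
... | yes _    | no b≢d   = no (λ { refl → b≢d refl })

-- Hedberg: Tree is a set, so the equality proofs inside <₃ and ≥ are unique.
≡-isProp : {x y : Tree} → isProp (x ≡ y)
≡-isProp = Decidable⇒UIP.≡-irrelevant _≟_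

<-irrefl : ∀ {a} → a < a → ⊥
<-irrefl (<₂ a<a)   = <-irrefl a<a
<-irrefl (<₃ _ b<b) = <-irrefl b<b

-- Any two proofs of a < b agree: <₂ and <₃ cannot both apply, since <₃
-- identifies the exponents that <₂ would make strictly smaller.
<-isProp : ∀ {a b} → isProp (a < b)
<-isProp <₁          <₁          = refl
<-isProp (<₂ p)      (<₂ q)      = cong <₂ (<-isProp p q)
<-isProp (<₂ a<a)    (<₃ refl _) = ⊥-elim (<-irrefl a<a)
<-isProp (<₃ refl _) (<₂ a<a)    = ⊥-elim (<-irrefl a<a)
<-isProp (<₃ e p)    (<₃ e′ q)   = cong₂ <₃ (≡-isProp e e′) (<-isProp p q)

⊎-isProp : ∀ {ℓ} {A B : Set ℓ} →
           isProp A → isProp B → (A → B → ⊥) → isProp (A ⊎ B)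
⊎-isProp propA propB disj (inj₁ x) (inj₁ x′) = cong inj₁ (propA x x′)
⊎-isProp propA propB disj (inj₁ x) (inj₂ y)  = ⊥-elim (disj x y)
⊎-isProp propA propB disj (inj₂ y) (inj₁ x)  = ⊥-elim (disj x y)
⊎-isProp propA propB disj (inj₂ y) (inj₂ y′) = cong inj₂ (propB y y′)

≥-isProp : ∀ {a b} → isProp (a ≥ b)
≥-isProp = ⊎-isProp <-isProp ≡-isProp (λ { b<a refl → <-irrefl b<a })

mainTheorem9 : (a : Tree) → isProp (isCNF a)
mainTheorem9 𝟎 𝟎IsCNF 𝟎IsCNF = refl
mainTheorem9 (ω^ a + b) (ω^+IsCNF p q r) (ω^+IsCNF p′ q′ r′)
  with mainTheorem9 a p p′ | mainTheorem9 b q q′ | ≥-isProp r r′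
... | refl | refl | refl = refl
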